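{- Let $\mathcal{F}$ be a set of natural number functions satisfying the standard conditions and closed under bounded summation. Let $\alpha:\mathbb{N}\to\mathbb{R}$ be $\mathcal{F}$-computable and define $\alpha^{\Sigma}:\mathbb{N}\to\mathbb{R}$ by $\alpha^{\Sigma}(m)=\sum_{n=0}^{m}\alpha(n)$. Then $\alpha^{\Sigma}$ is $\mathcal{F}$-computable.
   Context: $\mathbb{N}=\{0,1,2,\dots\}$. A set $\mathcal{F}$ of natural number functions (maps $\mathbb{N}^n\to\mathbb{N}$) satisfies the standard conditions if it contains the zero function, the successor function, all projections, addition, multiplication and modified subtraction $x\dot- y=\max(x-y,0)$, and is closed under composition. $\mathcal{F}$ is closed under bounded summation if whenever $f(t,x_1,\dots,x_n)\in\mathcal{F}$, the function $(x,x_1,\dots,x_n)\mapsto\sum_{t\le x}f(t,x_1,\dots,x_n)$ is in $\mathcal{F}$. An $\mathcal{F}$-2-sequence is a function $A:\mathbb{N}^2\to\mathbb{Q}$ of the form $A(x,n)=\frac{f(x,n)-g(x,n)}{h(x,n)+1}$ with $f,g,h:\mathbb{N}^2\to\mathbb{N}$ in $\mathcal{F}$. A function $\alpha:\mathbb{N}\to\mathbb{R}$ is $\mathcal{F}$-computable if there is an $\mathcal{F}$-2-sequence $A$ with $|A(x,n)-\alpha(n)|\le\frac1{x+1}$ for all $x,n\in\mathbb{N}$. -}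

module Defs where

open import Data.Nat as ℕ using (ℕ; zero; suc)
open import Data.Fin using (Fin)
open import Data.Product using (Σ; _×_)
open import Data.Vec.Functional using (Vector; _∷_; []; head; tail)
open import Relation.Binary.PropositionalEquality using (_≡_)
open import Relation.Binary.Structures using (IsTotalOrder)
open import Algebra.Structures using (IsCommutativeRing)
open import Relation.Nullary using (¬_)

Fn : ℕ → Set
Fn n = Vector ℕ n → ℕ

FunSet : Set₁
FunSet = (n : ℕ) → Fn n → Set

sumℕ : (ℕ → ℕ) → ℕ → ℕ
sumℕ f zero    = f zero
sumℕ f (suc x) = sumℕ f x ℕ.+ f (suc x)

⟨_,_⟩ : ℕ → ℕ → Vector ℕ 2
⟨ x , y ⟩ = x ∷ (y ∷ [])

record StandardConditions (F : FunSet) : Set where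
  field
    -- F is a *set of functions*: membership only depends on the function's values
    extensional : ∀ {n} {f g : Fn n} → F n f → (∀ v → f v ≡ g v) → F n g
    zeroF   : F 1 (λ _ → 0)
    sucF    : F 1 (λ v → suc (head v))
    projF   : ∀ n (i : Fin n) → F n (λ v → v i)
    addF    : F 2 (λ v → head v ℕ.+ head (tail v))
    mulF    : F 2 (λ v → head v ℕ.* head (tail v))
    monusF  : F 2 (λ v → head v ℕ.∸ head (tail v))
    compF   : ∀ {k n} {f : Fn k} {g : Fin k → Fn n} →
              F k f → (∀ i → F n (g i)) → F n (λ v → f (λ i → g i v))

-- closure under bounded summation (the summation variable t is the first argument)
ClosedUnderBoundedSum : FunSet → Set
ClosedUnderBoundedSum F =
  ∀ {n} {f : Fn (suc n)} → F (suc n) f →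
    F (suc n) (λ v → sumℕ (λ t → f (t ∷ tail v)) (head v))

-- An ordered field (stand-in for ℝ)
record OrderedField : Set₁ where
  infix  4 _≈_ _≤_
  infixl 6 _+_
  infixl 7 _*_
  infix  8 -_
  infix  9 _⁻¹
  field
    Carrier : Set
    _≈_ _≤_ : Carrier → Carrier → Set
    _+_ _*_ : Carrier → Carrier → Carrier
    -_ _⁻¹  : Carrier → Carrier
    0# 1#   : Carrier
    isCommutativeRing : IsCommutativeRing _≈_ _+_ _*_ -_ 0# 1#
    ⁻¹-inverse : ∀ x → ¬ (x ≈ 0#) → x * x ⁻¹ ≈ 1#
    0≉1        : ¬ (0# ≈ 1#)
    isTotalOrder : IsTotalOrder _≈_ _≤_
    +-mono-≤   : ∀ {x y} z → x ≤ y → x + z ≤ y + z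
    *-nonneg   : ∀ {x y} → 0# ≤ x → 0# ≤ y → 0# ≤ x * y

  infixl 6 _-_
  _-_ : Carrier → Carrier → Carrier
  x - y = x + - y

  fromℕ : ℕ → Carrier
  fromℕ zero    = 0#
  fromℕ (suc n) = 1# + fromℕ n

  sumTo : (ℕ → Carrier) → ℕ → Carrier
  sumTo α zero    = α zero
  sumTo α (suc m) = sumTo α m + α (suc m)

  AbsDiff≤ : Carrier → Carrier → Carrier → Set
  AbsDiff≤ a b c = (a - b ≤ c) × (b - a ≤ c)

module _ (R : OrderedField) where
  open OrderedField R

  seq2 : Fn 2 → Fn 2 → Fn 2 → ℕ → ℕ → Carrier
  seq2 f g h x n = (fromℕ (f ⟨ x , n ⟩) - fromℕ (g ⟨ x , n ⟩)) * (fromℕ (suc (h ⟨ x , n ⟩))) ⁻¹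

  Computable : FunSet → (ℕ → Carrier) → Set
  Computable F α =
    Σ (Fn 2) λ f → Σ (Fn 2) λ g → Σ (Fn 2) λ h →
      F 2 f × F 2 g × F 2 h ×
      (∀ x n → AbsDiff≤ (seq2 f g h x n) (α n) ((fromℕ (suc x)) ⁻¹))

-- Let A(x, n) = (f - g) / (h + 1) approximate α. To approximate Σ_{n ≤ m} α(n) within
-- 1/(x + 1), sample every summand at the precision y with y + 1 = 2 (m + 1) (x + 1) and
-- round both numerators down to the common denominator y + 1, i.e. replace f(y, n) by
-- ⌊f(y, n) (y + 1) / (h(y, n) + 1)⌋ and likewise g. The rounded difference is within
-- 1/(y + 1) of A(y, n), hence within 2/(y + 1) of α(n), and the m + 1 errors add up to
-- 1/(x + 1). With a common denominator the partial sum is a difference of bounded sums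
-- over y + 1, and these lie in F because floor division is itself a bounded sum of
-- indicators built from modified subtraction.
module Submission where

open import Defs
open import Data.Nat as ℕ using (ℕ; zero; suc)
import Data.Nat.Properties as ℕ
open import Data.Nat.DivMod using (_/_; m/n*n≤m; m/n≤m; m≡m%n+[m/n]*n; m%n<n)
open import Data.Fin using (Fin; zero; suc)
open import Data.Vec.Functional using (_∷_)
open import Data.Product using (_,_)
open import Data.Sum using (inj₁; inj₂)
open import Data.Empty using (⊥-elim)
open import Data.Maybe using (nothing)
open import Relation.Nullary using (¬_; yes; no)
import Relation.Binary.PropositionalEquality as ≡
open import Relation.Binary.Bundles using (Poset)
open import Relation.Binary.Structures using (IsTotalOrder)
open import Algebra.Bundles using (CommutativeRing)
open import Algebra.Structures using (IsCommutativeRing)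
import Algebra.Properties.AbelianGroup as AbelianGroupProperties
import Algebra.Properties.Ring as RingProperties
import Algebra.Properties.CommutativeSemigroup as CommutativeSemigroupProperties
import Relation.Binary.Reasoning.PartialOrder as PosetReasoning
open import Tactic.RingSolver.Core.AlmostCommutativeRing using (AlmostCommutativeRing; fromCommutativeRing)
open import Tactic.RingSolver using (solve-∀)
import Data.Nat.Tactic.RingSolver as ℕ-Solver

module FloorDivision where
  open import Data.Nat
  open import Data.Nat.Properties
  open import Relation.Binary.PropositionalEquality

  m<[1+m/n]*n : ∀ m n .{{_ : NonZero n}} → m < suc (m / n) * n
  m<[1+m/n]*n m n = ≤-<-trans (≤-reflexive (m≡m%n+[m/n]*n m n)) (+-monoˡ-< (m / n * n) (m%n<n m n))

  sumℕ-initialSegment : ∀ (ι : ℕ → ℕ) q → (∀ s → s < q → ι s ≡ 1) → (∀ s → q ≤ s → ι s ≡ 0) →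
                        ∀ k → sumℕ ι k ≡ suc k ⊓ q
  sumℕ-initialSegment ι q ι<q ι≥q zero with q
  ... | zero  = ι≥q 0 z≤n
  ... | suc _ = ι<q 0 z<s
  sumℕ-initialSegment ι q ι<q ι≥q (suc k) with suc k <? q
  ... | yes k+1<q = begin
    sumℕ ι k + ι (suc k)  ≡⟨ cong₂ _+_ (sumℕ-initialSegment ι q ι<q ι≥q k) (ι<q (suc k) k+1<q) ⟩
    suc k ⊓ q + 1         ≡⟨ cong (_+ 1) (m≤n⇒m⊓n≡m (<⇒≤ k+1<q)) ⟩
    suc k + 1             ≡⟨ +-comm (suc k) 1 ⟩
    suc (suc k)           ≡⟨ m≤n⇒m⊓n≡m k+1<q ⟨
    suc (suc k) ⊓ q       ∎
    where open ≡-Reasoning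
  ... | no k+1≮q = begin
    sumℕ ι k + ι (suc k)  ≡⟨ cong₂ _+_ (sumℕ-initialSegment ι q ι<q ι≥q k) (ι≥q (suc k) q≤k+1) ⟩
    suc k ⊓ q + 0         ≡⟨ +-identityʳ (suc k ⊓ q) ⟩
    suc k ⊓ q             ≡⟨ m≥n⇒m⊓n≡n q≤k+1 ⟩
    q                     ≡⟨ m≥n⇒m⊓n≡n (m≤n⇒m≤1+n q≤k+1) ⟨
    suc (suc k) ⊓ q       ∎
    where
    open ≡-Reasoning
    q≤k+1 = ≮⇒≥ k+1≮q

  -- 1 ∸ (k ∸ a) is the indicator of k ≤ a, so the sum counts the s ≤ a with (s + 1) n ≤ a.
  /≡sum-indicator : ∀ a n .{{_ : NonZero n}} → a / n ≡ sumℕ (λ s → 1 ∸ (suc s * n ∸ a)) a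
  /≡sum-indicator a n = sym (begin
    sumℕ (λ s → 1 ∸ (suc s * n ∸ a)) a ≡⟨ sumℕ-initialSegment _ (a / n) below above a ⟩
    suc a ⊓ (a / n)                    ≡⟨ m≥n⇒m⊓n≡n (m≤n⇒m≤1+n (m/n≤m a n)) ⟩
    a / n                              ∎)
    where
    open ≡-Reasoning
    below : ∀ s → s < a / n → 1 ∸ (suc s * n ∸ a) ≡ 1
    below s s<a/n = cong (1 ∸_) (m≤n⇒m∸n≡0 (≤-trans (*-monoˡ-≤ n s<a/n) (m/n*n≤m a n)))
    above : ∀ s → a / n ≤ s → 1 ∸ (suc s * n ∸ a) ≡ 0
    above s a/n≤s = m≤n⇒m∸n≡0 (m<n⇒0<n∸m (<-≤-trans (m<[1+m/n]*n a n) (*-monoˡ-≤ n (s≤s a/n≤s))))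

open FloorDivision

module Closure {F : FunSet} (SC : StandardConditions F) (BS : ClosedUnderBoundedSum F) where
  open import Data.Nat
  open StandardConditions SC

  pair-closed : ∀ {n} {a b : Fn n} → F n a → F n b → ∀ i → F n (λ v → ⟨ a v , b v ⟩ i)
  pair-closed a∈F b∈F zero       = a∈F
  pair-closed a∈F b∈F (suc zero) = b∈F

  comp₂-closed : ∀ {n} {f : Fn 2} {a b : Fn n} → F 2 f → F n a → F n b → F n (λ v → f ⟨ a v , b v ⟩)
  comp₂-closed f∈F a∈F b∈F = compF f∈F (pair-closed a∈F b∈F)

  *-closed : ∀ {n} {a b : Fn n} → F n a → F n b → F n (λ v → a v * b v)
  *-closed = comp₂-closed mulF

  ∸-closed : ∀ {n} {a b : Fn n} → F n a → F n b → F n (λ v → a v ∸ b v)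
  ∸-closed = comp₂-closed monusF

  suc-closed : ∀ {n} {a : Fn n} → F n a → F n (λ v → suc (a v))
  suc-closed a∈F = compF sucF (λ _ → a∈F)

  const-closed : ∀ {n} c → F (suc n) (λ _ → c)
  const-closed {n} zero    = compF zeroF (λ _ → projF (suc n) zero)
  const-closed     (suc c) = suc-closed (const-closed c)

  sum-closed : ∀ {k n} {f : Fn (suc k)} {bound : Fn n} {args : Fin k → Fn n} →
               F (suc k) f → F n bound → (∀ i → F n (args i)) →
               F n (λ v → sumℕ (λ t → f (t ∷ λ i → args i v)) (bound v))
  sum-closed {bound = bound} {args} f∈F bound∈F args∈F =
    compF {g = λ j v → (bound v ∷ λ i → args i v) j} (BS f∈F) λ where
      zero    → bound∈F
      (suc i) → args∈F i

  /-closed : ∀ {n} {a b : Fn n} → F n a → F n b → F n (λ v → a v / suc (b v))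
  /-closed {n} {a} {b} a∈F b∈F =
    extensional (sum-closed indicator∈F a∈F (pair-closed a∈F b∈F))
                (λ v → ≡.sym (/≡sum-indicator (a v) (suc (b v))))
    where
    indicator∈F : F 3 (λ w → 1 ∸ (suc (w zero) * suc (w (suc (suc zero))) ∸ w (suc zero)))
    indicator∈F =
      ∸-closed (const-closed 1)
               (∸-closed (*-closed (suc-closed (projF 3 zero)) (suc-closed (projF 3 (suc (suc zero)))))
                         (projF 3 (suc zero)))

module OrderedFieldProperties (R : OrderedField) where

  open OrderedField R
  open IsCommutativeRing isCommutativeRing
    using (refl; sym; trans; reflexive; +-cong; +-congˡ; +-congʳ; *-congˡ; *-congʳ; +-assoc; +-comm;
           *-comm; +-identityˡ; +-identityʳ; *-identityˡ; *-identityʳ; -‿inverseʳ; -‿cong; zeroˡ; distribʳ)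
  module ≤ = IsTotalOrder isTotalOrder

  commutativeRing : CommutativeRing _ _
  commutativeRing = record { isCommutativeRing = isCommutativeRing }

  open AbelianGroupProperties (CommutativeRing.+-abelianGroup commutativeRing)
    using (xyx⁻¹≈y; ⁻¹-anti-homo‿-)
  open RingProperties (CommutativeRing.ring commutativeRing)
    using (-1*x≈-x; -‿distribʳ-*; [y-z]x≈yx-zx; -‿involutive; //-rightDividesˡ; \\-leftDividesʳ)

  -- No zero test on coefficients: the solver below only proves identities
  -- in which nothing has to cancel; cancellations are done by hand.
  almostCommutativeRing : AlmostCommutativeRing _ _
  almostCommutativeRing = fromCommutativeRing commutativeRing (λ _ → nothing)

  open CommutativeSemigroupProperties (CommutativeRing.*-commutativeSemigroup commutativeRing)
    renaming (interchange to *-interchange) using ()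

  -‿interchange : ∀ a b c d → (a + b) - (c + d) ≈ (a - c) + (b - d)
  -‿interchange = ring-identity
    where
    module A = AlmostCommutativeRing almostCommutativeRing
    ring-identity : ∀ a b c d → (a A.+ b) A.+ A.- (c A.+ d) A.≈ (a A.+ A.- c) A.+ (b A.+ A.- d)
    ring-identity = solve-∀ almostCommutativeRing

  poset : Poset _ _ _
  poset = record { isPartialOrder = ≤.isPartialOrder }

  open PosetReasoning poset

  ≤-resp₂ : ∀ {a a' b b'} → a ≈ a' → b ≈ b' → a ≤ b → a' ≤ b'
  ≤-resp₂ a≈a' b≈b' a≤b = ≤.≤-respˡ-≈ a≈a' (≤.≤-respʳ-≈ b≈b' a≤b)

  +-mono-≤₂ : ∀ {a b c d} → a ≤ b → c ≤ d → a + c ≤ b + d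
  +-mono-≤₂ {a} {b} {c} {d} a≤b c≤d = begin
    a + c  ≤⟨ +-mono-≤ c a≤b ⟩
    b + c  ≈⟨ +-comm b c ⟩
    c + b  ≤⟨ +-mono-≤ b c≤d ⟩
    d + b  ≈⟨ +-comm d b ⟩
    b + d  ∎

  x≤y⇒0≤y-x : ∀ {x y} → x ≤ y → 0# ≤ y - x
  x≤y⇒0≤y-x {x} {y} x≤y = begin
    0#     ≈⟨ -‿inverseʳ x ⟨
    x - x  ≤⟨ +-mono-≤ (- x) x≤y ⟩
    y - x  ∎

  0≤y-x⇒x≤y : ∀ {x y} → 0# ≤ y - x → x ≤ y
  0≤y-x⇒x≤y {x} {y} 0≤y-x = begin
    x           ≈⟨ +-identityˡ x ⟨
    0# + x      ≤⟨ +-mono-≤ x 0≤y-x ⟩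
    y - x + x   ≈⟨ //-rightDividesˡ x y ⟩
    y           ∎

  x≤y+e⇒x-y≤e : ∀ {x y e} → x ≤ y + e → x - y ≤ e
  x≤y+e⇒x-y≤e {x} {y} {e} x≤y+e = begin
    x - y      ≤⟨ +-mono-≤ (- y) x≤y+e ⟩
    y + e - y  ≈⟨ xyx⁻¹≈y y e ⟩
    e          ∎

  x≤y⇒x-y≤0 : ∀ {x y} → x ≤ y → x - y ≤ 0#
  x≤y⇒x-y≤0 x≤y = x≤y+e⇒x-y≤e (≤.≤-respʳ-≈ (sym (+-identityʳ _)) x≤y)

  0≤1 : 0# ≤ 1#
  0≤1 with ≤.total 0# 1#
  ... | inj₁ 0≤1 = 0≤1
  ... | inj₂ 1≤0 = ≤.≤-respʳ-≈ -1*-1≈1 (*-nonneg 0≤-1 0≤-1)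
    where
    0≤-1 : 0# ≤ - 1#
    0≤-1 = ≤.≤-respʳ-≈ (+-identityˡ (- 1#)) (x≤y⇒0≤y-x 1≤0)
    -1*-1≈1 : - 1# * - 1# ≈ 1#
    -1*-1≈1 = trans (-1*x≈-x (- 1#)) (-‿involutive 1#)

  0≤x⇒0≤x⁻¹ : ∀ {x} → 0# ≤ x → ¬ x ≈ 0# → 0# ≤ x ⁻¹
  0≤x⇒0≤x⁻¹ {x} 0≤x x≉0 with ≤.total 0# (x ⁻¹)
  ... | inj₁ 0≤x⁻¹ = 0≤x⁻¹
  ... | inj₂ x⁻¹≤0 = ⊥-elim (0≉1 (≤.antisym 0≤1 1≤0))
    where
    0≤-1 : 0# ≤ - 1#
    0≤-1 = begin
      0#            ≤⟨ *-nonneg 0≤x (≤.≤-respʳ-≈ (+-identityˡ _) (x≤y⇒0≤y-x x⁻¹≤0)) ⟩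
      x * - x ⁻¹    ≈⟨ -‿distribʳ-* x (x ⁻¹) ⟨
      - (x * x ⁻¹)  ≈⟨ -‿cong (⁻¹-inverse x x≉0) ⟩
      - 1#          ∎
    1≤0 : 1# ≤ 0#
    1≤0 = 0≤y-x⇒x≤y (≤.≤-respʳ-≈ (sym (+-identityˡ (- 1#))) 0≤-1)

  *-monoˡ-≤-nonneg : ∀ {a b c} → 0# ≤ c → a ≤ b → a * c ≤ b * c
  *-monoˡ-≤-nonneg {a} {b} {c} 0≤c a≤b =
    0≤y-x⇒x≤y (≤.≤-respʳ-≈ ([y-z]x≈yx-zx c b a) (*-nonneg (x≤y⇒0≤y-x a≤b) 0≤c))

  0≤fromℕ : ∀ n → 0# ≤ fromℕ n
  0≤fromℕ zero    = ≤.refl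
  0≤fromℕ (suc n) = ≤.≤-respˡ-≈ (+-identityˡ 0#) (+-mono-≤₂ 0≤1 (0≤fromℕ n))

  fromℕ-suc≉0 : ∀ n → ¬ fromℕ (suc n) ≈ 0#
  fromℕ-suc≉0 n 1+n≈0 = 0≉1 (≤.antisym 0≤1 (begin
    1#               ≈⟨ +-identityʳ 1# ⟨
    1# + 0#          ≤⟨ +-mono-≤₂ ≤.refl (0≤fromℕ n) ⟩
    fromℕ (suc n)    ≈⟨ 1+n≈0 ⟩
    0#               ∎))

  fromℕ-+ : ∀ m n → fromℕ (m ℕ.+ n) ≈ fromℕ m + fromℕ n
  fromℕ-+ zero    n = sym (+-identityˡ (fromℕ n))
  fromℕ-+ (suc m) n = trans (+-congˡ (fromℕ-+ m n)) (sym (+-assoc 1# (fromℕ m) (fromℕ n)))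

  fromℕ-* : ∀ m n → fromℕ (m ℕ.* n) ≈ fromℕ m * fromℕ n
  fromℕ-* zero    n = sym (zeroˡ (fromℕ n))
  fromℕ-* (suc m) n = begin-equality
    fromℕ (n ℕ.+ m ℕ.* n)             ≈⟨ fromℕ-+ n (m ℕ.* n) ⟩
    fromℕ n + fromℕ (m ℕ.* n)         ≈⟨ +-cong (sym (*-identityˡ (fromℕ n))) (fromℕ-* m n) ⟩
    1# * fromℕ n + fromℕ m * fromℕ n  ≈⟨ distribʳ (fromℕ n) 1# (fromℕ m) ⟨
    (1# + fromℕ m) * fromℕ n          ∎

  fromℕ-mono : ∀ {m n} → m ℕ.≤ n → fromℕ m ≤ fromℕ n
  fromℕ-mono {m} {n} m≤n = begin
    fromℕ m                   ≈⟨ +-identityʳ (fromℕ m) ⟨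
    fromℕ m + 0#              ≤⟨ +-mono-≤₂ ≤.refl (0≤fromℕ (n ℕ.∸ m)) ⟩
    fromℕ m + fromℕ (n ℕ.∸ m) ≈⟨ fromℕ-+ m (n ℕ.∸ m) ⟨
    fromℕ (m ℕ.+ (n ℕ.∸ m))   ≈⟨ reflexive (≡.cong fromℕ (ℕ.m+[n∸m]≡n m≤n)) ⟩
    fromℕ n                   ∎

  frac : ℕ → ℕ → Carrier
  frac a d = fromℕ a * fromℕ (suc d) ⁻¹

  0≤fromℕ-suc⁻¹ : ∀ d → 0# ≤ fromℕ (suc d) ⁻¹
  0≤fromℕ-suc⁻¹ d = 0≤x⇒0≤x⁻¹ (0≤fromℕ (suc d)) (fromℕ-suc≉0 d)

  frac≈common-denominator : ∀ a c d →
    frac a c ≈ fromℕ (a ℕ.* suc d) * (fromℕ (suc c) ⁻¹ * fromℕ (suc d) ⁻¹)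
  frac≈common-denominator a c d = begin-equality
    A * C⁻¹                  ≈⟨ *-identityʳ (A * C⁻¹) ⟨
    A * C⁻¹ * 1#             ≈⟨ *-congˡ (⁻¹-inverse D (fromℕ-suc≉0 d)) ⟨
    A * C⁻¹ * (D * D ⁻¹)     ≈⟨ *-interchange A C⁻¹ D (D ⁻¹) ⟩
    A * D * (C⁻¹ * D ⁻¹)     ≈⟨ *-congʳ (fromℕ-* a (suc d)) ⟨
    fromℕ (a ℕ.* suc d) * (C⁻¹ * D ⁻¹)  ∎
    where
    A = fromℕ a
    C⁻¹ = fromℕ (suc c) ⁻¹
    D = fromℕ (suc d)

  frac-mono : ∀ a b c d → a ℕ.* suc d ℕ.≤ b ℕ.* suc c → frac a c ≤ frac b d
  frac-mono a b c d ad≤bc = begin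
    frac a c                             ≈⟨ frac≈common-denominator a c d ⟩
    fromℕ (a ℕ.* suc d) * (C⁻¹ * D⁻¹)    ≤⟨ *-monoˡ-≤-nonneg (*-nonneg (0≤fromℕ-suc⁻¹ c) (0≤fromℕ-suc⁻¹ d))
                                                              (fromℕ-mono ad≤bc) ⟩
    fromℕ (b ℕ.* suc c) * (C⁻¹ * D⁻¹)    ≈⟨ *-congˡ (*-comm C⁻¹ D⁻¹) ⟩
    fromℕ (b ℕ.* suc c) * (D⁻¹ * C⁻¹)    ≈⟨ frac≈common-denominator b d c ⟨
    frac b d                             ∎
    where
    C⁻¹ = fromℕ (suc c) ⁻¹
    D⁻¹ = fromℕ (suc d) ⁻¹

  frac-cong : ∀ a b c d → a ℕ.* suc d ≡.≡ b ℕ.* suc c → frac a c ≈ frac b d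
  frac-cong a b c d ad≡bc =
    ≤.antisym (frac-mono a b c d (ℕ.≤-reflexive ad≡bc))
              (frac-mono b a d c (ℕ.≤-reflexive (≡.sym ad≡bc)))

  frac-+ : ∀ a b d → frac (a ℕ.+ b) d ≈ frac a d + frac b d
  frac-+ a b d = trans (*-congʳ (fromℕ-+ a b)) (distribʳ _ (fromℕ a) (fromℕ b))

  fromℕ-suc-* : ∀ n x → fromℕ (suc n) * x ≈ fromℕ n * x + x
  fromℕ-suc-* n x = begin-equality
    (1# + fromℕ n) * x    ≈⟨ *-congʳ (+-comm 1# (fromℕ n)) ⟩
    (fromℕ n + 1#) * x    ≈⟨ distribʳ x (fromℕ n) 1# ⟩
    fromℕ n * x + 1# * x  ≈⟨ +-congˡ (*-identityˡ x) ⟩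
    fromℕ n * x + x       ∎

  frac-rounded-≤ : ∀ p h y → frac (p ℕ.* suc y / suc h) y ≤ frac p h
  frac-rounded-≤ p h y = frac-mono (p ℕ.* suc y / suc h) p y h (m/n*n≤m (p ℕ.* suc y) (suc h))

  frac-≤-rounded+ : ∀ p h y → frac p h ≤ frac (p ℕ.* suc y / suc h) y + fromℕ (suc y) ⁻¹
  frac-≤-rounded+ p h y = begin
    frac p h                      ≤⟨ frac-mono p (suc q) h y (ℕ.<⇒≤ (m<[1+m/n]*n (p ℕ.* suc y) (suc h))) ⟩
    frac (suc q) y                ≈⟨ fromℕ-suc-* q (fromℕ (suc y) ⁻¹) ⟩
    frac q y + fromℕ (suc y) ⁻¹   ∎
    where q = p ℕ.* suc y / suc h

  AbsDiff≤-resp : ∀ {a a' b b' c c'} → a ≈ a' → b ≈ b' → c ≈ c' → AbsDiff≤ a b c → AbsDiff≤ a' b' c'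
  AbsDiff≤-resp a≈a' b≈b' c≈c' (a-b≤c , b-a≤c) =
      ≤-resp₂ (+-cong a≈a' (-‿cong b≈b')) c≈c' a-b≤c
    , ≤-resp₂ (+-cong b≈b' (-‿cong a≈a')) c≈c' b-a≤c

  AbsDiff≤-+ : ∀ {a a' b b' c c'} → AbsDiff≤ a b c → AbsDiff≤ a' b' c' →
               AbsDiff≤ (a + a') (b + b') (c + c')
  AbsDiff≤-+ {a} {a'} {b} {b'} (a-b≤c , b-a≤c) (a'-b'≤c' , b'-a'≤c') =
      ≤.≤-respˡ-≈ (sym (-‿interchange a a' b b')) (+-mono-≤₂ a-b≤c a'-b'≤c')
    , ≤.≤-respˡ-≈ (sym (-‿interchange b b' a a')) (+-mono-≤₂ b-a≤c b'-a'≤c')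

  x-z≈[x-y]+[y-z] : ∀ x y z → x - z ≈ (x - y) + (y - z)
  x-z≈[x-y]+[y-z] x y z = begin-equality
    x - z                ≈⟨ +-congˡ (\\-leftDividesʳ y (- z)) ⟨
    x + (- y + (y - z))  ≈⟨ +-assoc x (- y) (y - z) ⟨
    (x - y) + (y - z)    ∎

  AbsDiff≤-trans : ∀ {a b c d e} → AbsDiff≤ a b d → AbsDiff≤ b c e → AbsDiff≤ a c (d + e)
  AbsDiff≤-trans {a} {b} {c} {d} {e} (a-b≤d , b-a≤d) (b-c≤e , c-b≤e) =
      ≤.≤-respˡ-≈ (sym (x-z≈[x-y]+[y-z] a b c)) (+-mono-≤₂ a-b≤d b-c≤e)
    , ≤-resp₂ (sym (x-z≈[x-y]+[y-z] c b a)) (+-comm e d) (+-mono-≤₂ c-b≤e b-a≤d)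

  [p-q]-[r-s]≈[p-r]+[s-q] : ∀ p q r s → (p - q) - (r - s) ≈ (p - r) + (s - q)
  [p-q]-[r-s]≈[p-r]+[s-q] p q r s = trans (+-congˡ (⁻¹-anti-homo‿- r s)) (ring-identity p q r s)
    where
    module A = AlmostCommutativeRing almostCommutativeRing
    ring-identity : ∀ p q r s → (p A.+ A.- q) A.+ (s A.+ A.- r) A.≈ (p A.+ A.- r) A.+ (s A.+ A.- q)
    ring-identity = solve-∀ almostCommutativeRing

  AbsDiff≤-sub-rounded : ∀ {u v a b e} → u ≤ a → a ≤ u + e → v ≤ b → b ≤ v + e →
                         AbsDiff≤ (u - v) (a - b) e
  AbsDiff≤-sub-rounded {u} {v} {a} {b} {e} u≤a a≤u+e v≤b b≤v+e =
      ≤-resp₂ (sym ([p-q]-[r-s]≈[p-r]+[s-q] u v a b)) (+-identityˡ e)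
              (+-mono-≤₂ (x≤y⇒x-y≤0 u≤a) (x≤y+e⇒x-y≤e b≤v+e))
    , ≤-resp₂ (sym ([p-q]-[r-s]≈[p-r]+[s-q] a b u v)) (+-identityʳ e)
              (+-mono-≤₂ (x≤y+e⇒x-y≤e a≤u+e) (x≤y⇒x-y≤0 v≤b))

  AbsDiff≤-sumTo : ∀ {T β : ℕ → Carrier} {e} → (∀ n → AbsDiff≤ (T n) (β n) e) →
                   ∀ m → AbsDiff≤ (sumTo T m) (sumTo β m) (fromℕ (suc m) * e)
  AbsDiff≤-sumTo {e = e} T≈β zero    = AbsDiff≤-resp refl refl (sym 1*e≈e) (T≈β 0)
    where
    1*e≈e : fromℕ 1 * e ≈ e
    1*e≈e = trans (fromℕ-suc-* 0 e) (trans (+-congʳ (zeroˡ e)) (+-identityˡ e))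
  AbsDiff≤-sumTo {e = e} T≈β (suc m) =
    AbsDiff≤-resp refl refl (sym (fromℕ-suc-* (suc m) e)) (AbsDiff≤-+ (AbsDiff≤-sumTo T≈β m) (T≈β (suc m)))

  sumTo-frac-sub : ∀ (p q : ℕ → ℕ) d m →
    sumTo (λ n → frac (p n) d - frac (q n) d) m ≈ frac (sumℕ p m) d - frac (sumℕ q m) d
  sumTo-frac-sub p q d zero    = refl
  sumTo-frac-sub p q d (suc m) = begin-equality
    sumTo (λ n → frac (p n) d - frac (q n) d) m + (frac p′ d - frac q′ d)
      ≈⟨ +-congʳ (sumTo-frac-sub p q d m) ⟩
    (frac (sumℕ p m) d - frac (sumℕ q m) d) + (frac p′ d - frac q′ d)
      ≈⟨ -‿interchange _ _ _ _ ⟨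
    (frac (sumℕ p m) d + frac p′ d) - (frac (sumℕ q m) d + frac q′ d)
      ≈⟨ +-cong (frac-+ (sumℕ p m) p′ d) (-‿cong (frac-+ (sumℕ q m) q′ d)) ⟨
    frac (sumℕ p (suc m)) d - frac (sumℕ q (suc m)) d
      ∎
    where
    p′ = p (suc m)
    q′ = q (suc m)

  seq2≈frac-frac : ∀ f g h x n →
    seq2 R f g h x n ≈ frac (f ⟨ x , n ⟩) (h ⟨ x , n ⟩) - frac (g ⟨ x , n ⟩) (h ⟨ x , n ⟩)
  seq2≈frac-frac f g h x n = [y-z]x≈yx-zx _ (fromℕ (f ⟨ x , n ⟩)) (fromℕ (g ⟨ x , n ⟩))

  frac-sub-rounded : ∀ p q h y →
    AbsDiff≤ (frac (p ℕ.* suc y / suc h) y - frac (q ℕ.* suc y / suc h) y)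
             (frac p h - frac q h) (fromℕ (suc y) ⁻¹)
  frac-sub-rounded p q h y =
    AbsDiff≤-sub-rounded (frac-rounded-≤ p h y) (frac-≤-rounded+ p h y)
                         (frac-rounded-≤ q h y) (frac-≤-rounded+ q h y)

-- The product is a successor by computation, so suc (precision x m) reduces to it.
precision : ℕ → ℕ → ℕ
precision x m = 2 ℕ.* suc m ℕ.* suc x ℕ.∸ 1

module RoundedPartialSums (h : Fn 2) where
  open import Data.Nat

  rounded : Fn 2 → ℕ → ℕ → ℕ → ℕ
  rounded p x m t = p ⟨ y , t ⟩ * suc y / suc (h ⟨ y , t ⟩)
    where y = precision x m

  roundedSum : Fn 2 → Fn 2
  roundedSum p v = sumℕ (rounded p (v zero) (v (suc zero))) (v (suc zero))

  precision₂ : Fn 2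
  precision₂ v = precision (v zero) (v (suc zero))

  module _ {F : FunSet} (SC : StandardConditions F) (BS : ClosedUnderBoundedSum F) (h∈F : F 2 h) where
    open StandardConditions SC
    open Closure SC BS

    precision-closed : ∀ {n} {a b : Fn (suc n)} → F (suc n) a → F (suc n) b →
                       F (suc n) (λ v → precision (a v) (b v))
    precision-closed a∈F b∈F =
      ∸-closed (*-closed (*-closed (const-closed 2) (suc-closed b∈F)) (suc-closed a∈F)) (const-closed 1)

    precision₂-closed : F 2 precision₂
    precision₂-closed = precision-closed (projF 2 zero) (projF 2 (suc zero))

    roundedSum-closed : ∀ {p} → F 2 p → F 2 (roundedSum p)
    roundedSum-closed {p} p∈F = sum-closed rounded∈F (projF 2 (suc zero)) (projF 2)
      where
      y∈F : F 3 (λ w → precision (w (suc zero)) (w (suc (suc zero))))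
      y∈F = precision-closed (projF 3 (suc zero)) (projF 3 (suc (suc zero)))
      rounded∈F : F 3 (λ w → rounded p (w (suc zero)) (w (suc (suc zero))) (w zero))
      rounded∈F = /-closed (*-closed (comp₂-closed p∈F y∈F (projF 3 zero)) (suc-closed y∈F))
                           (comp₂-closed h∈F y∈F (projF 3 zero))

module Approximation (R : OrderedField) (f g h : Fn 2) (α : ℕ → OrderedField.Carrier R) where
  open OrderedField R
  open OrderedFieldProperties R
  open IsCommutativeRing isCommutativeRing
    using (refl; sym; trans; *-congʳ; +-identityʳ; *-identityˡ; distribˡ; distribʳ)
  open RoundedPartialSums h
  open PosetReasoning poset

  error-budget : ∀ x m → let e = fromℕ (suc (precision x m)) ⁻¹ in
                 fromℕ (suc m) * (e + e) ≈ fromℕ (suc x) ⁻¹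
  error-budget x m = begin-equality
    M * (e + e)                     ≈⟨ distribˡ M e e ⟩
    M * e + M * e                   ≈⟨ distribʳ e M M ⟨
    (M + M) * e                     ≈⟨ *-congʳ (fromℕ-+ (suc m) (suc m)) ⟨
    frac (suc m ℕ.+ suc m) y        ≈⟨ frac-cong (suc m ℕ.+ suc m) 1 y x (cross-multiplied x m) ⟩
    frac 1 x                        ≈⟨ *-congʳ (+-identityʳ 1#) ⟩
    1# * fromℕ (suc x) ⁻¹           ≈⟨ *-identityˡ _ ⟩
    fromℕ (suc x) ⁻¹                ∎
    where
    y = precision x m
    M = fromℕ (suc m)
    e = fromℕ (suc y) ⁻¹
    cross-multiplied : ∀ x m → (suc m ℕ.+ suc m) ℕ.* suc x ≡.≡ 1 ℕ.* (2 ℕ.* suc m ℕ.* suc x)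
    cross-multiplied = ℕ-Solver.solve-∀

  roundedSum-approximates : (∀ x n → AbsDiff≤ (seq2 R f g h x n) (α n) (fromℕ (suc x) ⁻¹)) →
    ∀ x m → AbsDiff≤ (seq2 R (roundedSum f) (roundedSum g) precision₂ x m) (sumTo α m) (fromℕ (suc x) ⁻¹)
  roundedSum-approximates A≈α x m =
    AbsDiff≤-resp sum≈seq2 refl (error-budget x m) (AbsDiff≤-sumTo term≈α m)
    where
    y = precision x m
    term : ℕ → Carrier
    term t = frac (rounded f x m t) y - frac (rounded g x m t) y
    term≈α : ∀ t → AbsDiff≤ (term t) (α t) (fromℕ (suc y) ⁻¹ + fromℕ (suc y) ⁻¹)
    term≈α t = AbsDiff≤-trans (frac-sub-rounded (f ⟨ y , t ⟩) (g ⟨ y , t ⟩) (h ⟨ y , t ⟩) y)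
                              (AbsDiff≤-resp (seq2≈frac-frac f g h y t) refl refl (A≈α y t))
    sum≈seq2 : sumTo term m ≈ seq2 R (roundedSum f) (roundedSum g) precision₂ x m
    sum≈seq2 = trans (sumTo-frac-sub (rounded f x m) (rounded g x m) y m)
                     (sym (seq2≈frac-frac (roundedSum f) (roundedSum g) precision₂ x m))

mainTheorem14 : (R : OrderedField) (F : FunSet) →
    StandardConditions F → ClosedUnderBoundedSum F →
    (α : ℕ → OrderedField.Carrier R) → Computable R F α →
    Computable R F (OrderedField.sumTo R α)
mainTheorem14 R F SC BS α (f , g , h , f∈F , g∈F , h∈F , A≈α) =
    roundedSum f , roundedSum g , precision₂
  , roundedSum-closed SC BS h∈F f∈F , roundedSum-closed SC BS h∈F g∈F , precision₂-closed SC BS h∈F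
  , roundedSum-approximates A≈α
  where
  open RoundedPartialSums h
  open Approximation R f g h α
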